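{- The ideal $I = \langle x^2+y^2+z^2\rangle \subset K[x,y,z]$ does not contain a non-zero binomial.
   Context: $K$ is a field and $K[x,y,z]$ the polynomial ring in three variables. A binomial is a polynomial with at most two terms. -}

module Defs where

open import Level using (Level; _⊔_) renaming (suc to lsuc)
open import Algebra.Bundles using (CommutativeRing)
open import Data.Nat using (ℕ; zero; suc; _∸_; _<_) renaming (_+_ to _+ℕ_)
open import Data.Product using (_×_; _,_; ∃; Σ)
open import Relation.Nullary using (¬_)
open import Relation.Binary.PropositionalEquality using (_≡_; _≢_)

record Field (c ℓ : Level) : Set (lsuc (c ⊔ ℓ)) where
  field
    commutativeRing : CommutativeRing c ℓ
  open CommutativeRing commutativeRing public
  field
    0≉1     : ¬ (0# ≈ 1#)
    inverse : ∀ x → ¬ (x ≈ 0#) → ∃ λ y → (x * y) ≈ 1#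

-- Exponent vectors of monomials x^a y^b z^c.
Monomial : Set
Monomial = ℕ × ℕ × ℕ

module Poly3 {c ℓ : Level} (K : Field c ℓ) where
  open Field K

  -- Polynomials in K[x,y,z] are coefficient functions with finite support.
  Coeffs : Set c
  Coeffs = Monomial → Carrier

  FinSupp : Coeffs → Set ℓ
  FinSupp f = ∃ λ N → ∀ a b d → N < a +ℕ b +ℕ d → f (a , b , d) ≈ 0#

  sumTo : ℕ → (ℕ → Carrier) → Carrier
  sumTo zero    g = g 0
  sumTo (suc n) g = sumTo n g + g (suc n)

  mul : Coeffs → Coeffs → Coeffs
  mul f g (a , b , d) =
    sumTo a λ i → sumTo b λ j → sumTo d λ k →
      f (i , j , k) * g (a ∸ i , b ∸ j , d ∸ k)

  gen : Coeffs
  gen (2 , 0 , 0) = 1#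
  gen (0 , 2 , 0) = 1#
  gen (0 , 0 , 2) = 1#
  gen _           = 0#

  InPrincipalIdeal : Coeffs → Coeffs → Set (c ⊔ ℓ)
  InPrincipalIdeal g f = ∃ λ h → FinSupp h × (∀ m → f m ≈ mul h g m)

  IsBinomial : Coeffs → Set ℓ
  IsBinomial f = FinSupp f × (∃ λ m₁ → ∃ λ m₂ → ∀ m → m ≢ m₁ → m ≢ m₂ → f m ≈ 0#)

  NonZeroPoly : Coeffs → Set ℓ
  NonZeroPoly f = ∃ λ m → ¬ (f m ≈ 0#)

module Submission where

-- Suppose f = h·(x²+y²+z²) is a non-zero binomial.  Then h ≠ 0,
-- and since h has finitely many terms we may (the goal being a negation)
-- decide which of its coefficients vanish.  Choose a term x^a y^b z^d of h of
-- maximal x-degree.  The coefficient of f at x^(a+2) y^b z^d only receives the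
-- contribution h(a,b,d)·1: the products coming from y² and z² would need a term
-- of h of x-degree a+2.  So x^(a+2) y^b z^d lies in the support of f, and so do
-- the analogous monomials for a y-maximal and a z-maximal term of h.  These
-- three monomials are pairwise distinct (the x-maximal one has the largest
-- x-degree, ...), which is impossible for a binomial.

open import Defs
open import Level using (Level; _⊔_)
open import Function using (_∘_)
open import Data.Nat using (ℕ; zero; suc; _∸_; _≤_; _<_; z≤n; s≤s; _<?_) renaming (_+_ to _+ℕ_)
open import Data.Nat.Properties
  using (≤-refl; ≤-trans; m≤n⇒m≤1+n; m≤n⇒m<n∨m≡n; n≤1+n; 1+n≰n; ≮⇒≥; m≤m+n; m≤n+m;
         m>n⇒m∸n≢0; m+n∸n≡m; n∸n≡0; ∸-cancelˡ-≡)
open import Data.Product using (_×_; _,_; ∃)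
open import Data.Sum using (_⊎_; inj₁; inj₂; [_,_]′)
open import Data.Empty using (⊥; ⊥-elim)
open import Relation.Nullary using (¬_; Dec; yes; no; ¬¬-excluded-middle)
open import Relation.Unary using (Decidable)
open import Relation.Binary.PropositionalEquality
  using (_≡_; _≢_; refl; sym; trans; cong; cong₂; subst)

¬¬-∀≤ : ∀ {p} {P : ℕ → Set p} n → (∀ i → i ≤ n → ¬ ¬ P i) → ¬ ¬ (∀ i → i ≤ n → P i)
¬¬-∀≤ zero hyp k = hyp 0 z≤n λ P0 → k λ { _ z≤n → P0 }
¬¬-∀≤ {P = P} (suc n) hyp k =
  ¬¬-∀≤ n (λ i i≤n → hyp i (m≤n⇒m≤1+n i≤n)) λ below →
  hyp (suc n) ≤-refl λ last → k (extend below last)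
  where
  extend : (∀ i → i ≤ n → P i) → P (suc n) → ∀ i → i ≤ suc n → P i
  extend below last i i≤1+n with m≤n⇒m<n∨m≡n i≤1+n
  ... | inj₁ (s≤s i≤n) = below i i≤n
  ... | inj₂ refl      = last

-- If everything vanishes from some degree on but not everywhere, a top element
-- exists (classically, hence under ¬¬): descend from the vanishing degree.
module TopDegree {a z} {A : Set a} (Zero : A → Set z) (Zero? : Decidable Zero) (deg : A → ℕ) where

  VanishesFrom : ℕ → Set (a ⊔ z)
  VanishesFrom n = ∀ m → n ≤ deg m → Zero m

  IsTop : A → Set (a ⊔ z)
  IsTop p = ¬ Zero p × VanishesFrom (suc (deg p))

  descend : ¬ ∃ IsTop → ∀ n → VanishesFrom (suc n) → VanishesFrom n
  descend noTop n above m n≤deg with m≤n⇒m<n∨m≡n n≤deg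
  ... | inj₁ n<deg = above m n<deg
  ... | inj₂ refl with Zero? m
  ...   | yes vanishes = vanishes
  ...   | no nonzero   = ⊥-elim (noTop (m , nonzero , above))

  vanishes-everywhere : ¬ ∃ IsTop → ∀ n → VanishesFrom n → ∀ m → Zero m
  vanishes-everywhere noTop zero    vanish m = vanish m z≤n
  vanishes-everywhere noTop (suc n) vanish   =
    vanishes-everywhere noTop n (descend noTop n vanish)

  top-exists : ∃ VanishesFrom → ¬ (∀ m → Zero m) → ¬ ¬ ∃ IsTop
  top-exists (n , vanish) notAllZero noTop =
    notAllZero (vanishes-everywhere noTop n vanish)

data Axis : Set where
  x y z : Axis

coord : Axis → Monomial → ℕ
coord x (a , _ , _) = a
coord y (_ , b , _) = b
coord z (_ , _ , d) = d

bump : Axis → Monomial → Monomial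
bump x (a , b , d) = (2 +ℕ a , b , d)
bump y (a , b , d) = (a , 2 +ℕ b , d)
bump z (a , b , d) = (a , b , 2 +ℕ d)

origin : Monomial
origin = (0 , 0 , 0)

sq : Axis → Monomial
sq e = bump e origin

_≤ₘ_ : Monomial → Monomial → Set
(i , j , k) ≤ₘ (a , b , d) = i ≤ a × j ≤ b × k ≤ d

_∸ₘ_ : Monomial → Monomial → Monomial
(a , b , d) ∸ₘ (i , j , k) = (a ∸ i , b ∸ j , d ∸ k)

coord-≤-degree : ∀ e a b d → coord e (a , b , d) ≤ a +ℕ b +ℕ d
coord-≤-degree x a b d = ≤-trans (m≤m+n a b) (m≤m+n _ d)
coord-≤-degree y a b d = ≤-trans (m≤n+m b a) (m≤m+n _ d)
coord-≤-degree z a b d = m≤n+m d _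

coord-bump : ∀ e m → coord e (bump e m) ≡ 2 +ℕ coord e m
coord-bump x m = refl
coord-bump y m = refl
coord-bump z m = refl

coord-bump-other : ∀ e e' m → e ≡ e' ⊎ coord e (bump e' m) ≡ coord e m
coord-bump-other x x m = inj₁ refl
coord-bump-other y y m = inj₁ refl
coord-bump-other z z m = inj₁ refl
coord-bump-other x y m = inj₂ refl
coord-bump-other x z m = inj₂ refl
coord-bump-other y x m = inj₂ refl
coord-bump-other y z m = inj₂ refl
coord-bump-other z x m = inj₂ refl
coord-bump-other z y m = inj₂ refl

coord-origin : ∀ e → coord e origin ≡ 0
coord-origin x = refl
coord-origin y = refl
coord-origin z = refl

coord-∸ₘ : ∀ e m i → coord e (m ∸ₘ i) ≡ coord e m ∸ coord e i
coord-∸ₘ x m i = refl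
coord-∸ₘ y m i = refl
coord-∸ₘ z m i = refl

sq-axis : ∀ e e' → coord e (sq e') ≢ 0 → e ≡ e'
sq-axis e e' nonzero with coord-bump-other e e' origin
... | inj₁ same  = same
... | inj₂ other = ⊥-elim (nonzero (trans other (coord-origin e)))

≤ₘ-bump : ∀ e m → m ≤ₘ bump e m
≤ₘ-bump x (a , b , d) = m≤n+m a 2 , ≤-refl , ≤-refl
≤ₘ-bump y (a , b , d) = ≤-refl , m≤n+m b 2 , ≤-refl
≤ₘ-bump z (a , b , d) = ≤-refl , ≤-refl , m≤n+m d 2

bump-∸ₘ : ∀ e m → bump e m ∸ₘ m ≡ sq e
bump-∸ₘ x (a , b , d) rewrite m+n∸n≡m 2 a | n∸n≡0 b | n∸n≡0 d = refl
bump-∸ₘ y (a , b , d) rewrite m+n∸n≡m 2 b | n∸n≡0 a | n∸n≡0 d = refl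
bump-∸ₘ z (a , b , d) rewrite m+n∸n≡m 2 d | n∸n≡0 a | n∸n≡0 b = refl

∸ₘ-cancelˡ : ∀ {m i j} → i ≤ₘ m → j ≤ₘ m → m ∸ₘ i ≡ m ∸ₘ j → i ≡ j
∸ₘ-cancelˡ (i₁ , i₂ , i₃) (j₁ , j₂ , j₃) eq =
  cong₂ _,_ (∸-cancelˡ-≡ i₁ j₁ (cong (coord x) eq))
    (cong₂ _,_ (∸-cancelˡ-≡ i₂ j₂ (cong (coord y) eq)) (∸-cancelˡ-≡ i₃ j₃ (cong (coord z) eq)))

¬¬-∀-cofinite : ∀ {p} {P : Monomial → Set p} N →
  (∀ a b d → N < a +ℕ b +ℕ d → P (a , b , d)) → (∀ m → ¬ ¬ P m) → ¬ ¬ (∀ m → P m)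
¬¬-∀-cofinite {P = P} N outside hyp k =
  ¬¬-∀≤ N (λ a _ → ¬¬-∀≤ N (λ b _ → ¬¬-∀≤ N (λ d _ → hyp (a , b , d)))) λ box →
  k (everywhere box)
  where
  everywhere : (∀ a → a ≤ N → ∀ b → b ≤ N → ∀ d → d ≤ N → P (a , b , d)) → ∀ m → P m
  everywhere box (a , b , d) with N <? a +ℕ b +ℕ d
  ... | yes above = outside a b d above
  ... | no within =
    box a (bounded x) b (bounded y) d (bounded z)
    where
    bounded : ∀ e → coord e (a , b , d) ≤ N
    bounded e = ≤-trans (coord-≤-degree e a b d) (≮⇒≥ within)

pigeonhole : ∀ {a} {A : Set a} {m₁ m₂ t₁ t₂ t₃ : A} →
  t₁ ≡ m₁ ⊎ t₁ ≡ m₂ → t₂ ≡ m₁ ⊎ t₂ ≡ m₂ → t₃ ≡ m₁ ⊎ t₃ ≡ m₂ →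
  t₁ ≡ t₂ ⊎ t₁ ≡ t₃ ⊎ t₂ ≡ t₃
pigeonhole (inj₁ refl) (inj₁ refl) _           = inj₁ refl
pigeonhole (inj₂ refl) (inj₂ refl) _           = inj₁ refl
pigeonhole (inj₁ refl) (inj₂ refl) (inj₁ refl) = inj₂ (inj₁ refl)
pigeonhole (inj₂ refl) (inj₁ refl) (inj₂ refl) = inj₂ (inj₁ refl)
pigeonhole (inj₁ refl) (inj₂ refl) (inj₂ refl) = inj₂ (inj₂ refl)
pigeonhole (inj₂ refl) (inj₁ refl) (inj₁ refl) = inj₂ (inj₂ refl)

module Polynomials {c ℓ : Level} (K : Field c ℓ) where
  open Field K using (Carrier; _≈_; _*_; 0#; 1#; +-cong; *-cong; +-identityˡ; +-identityʳ;
                      *-identityʳ; zeroˡ; zeroʳ)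
                 renaming (refl to ≈-refl; trans to ≈-trans; reflexive to ≈-reflexive)
  open Poly3 K

  sumTo-zero : ∀ n (g : ℕ → Carrier) → (∀ i → i ≤ n → g i ≈ 0#) → sumTo n g ≈ 0#
  sumTo-zero zero    g vanish = vanish 0 z≤n
  sumTo-zero (suc n) g vanish =
    ≈-trans (+-cong (sumTo-zero n g λ i i≤n → vanish i (m≤n⇒m≤1+n i≤n)) (vanish (suc n) ≤-refl))
            (+-identityˡ 0#)

  sumTo-single : ∀ n (g : ℕ → Carrier) i₀ → i₀ ≤ n → (∀ i → i ≤ n → i ≢ i₀ → g i ≈ 0#) →
    sumTo n g ≈ g i₀
  sumTo-single zero g zero z≤n others = ≈-refl
  sumTo-single (suc n) g i₀ i₀≤1+n others with m≤n⇒m<n∨m≡n i₀≤1+n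
  ... | inj₂ refl =
    ≈-trans (+-cong (sumTo-zero n g λ i i≤n → others i (m≤n⇒m≤1+n i≤n) (λ { refl → 1+n≰n i≤n }))
                    ≈-refl)
            (+-identityˡ _)
  ... | inj₁ (s≤s i₀≤n) =
    ≈-trans (+-cong (sumTo-single n g i₀ i₀≤n λ i i≤n → others i (m≤n⇒m≤1+n i≤n))
                    (others (suc n) ≤-refl λ { refl → 1+n≰n i₀≤n }))
            (+-identityʳ _)

  mul-single-term : ∀ (h g : Coeffs) m i₀ → i₀ ≤ₘ m →
    (∀ i → i ≤ₘ m → i ≢ i₀ → h i * g (m ∸ₘ i) ≈ 0#) → mul h g m ≈ h i₀ * g (m ∸ₘ i₀)
  mul-single-term h g (a , b , d) (i₀ , j₀ , k₀) (i₀≤a , j₀≤b , k₀≤d) others =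
    ≈-trans (sumTo-single a _ i₀ i₀≤a λ i i≤a i≢i₀ →
               sumTo-zero b _ λ j j≤b → sumTo-zero d _ λ k k≤d →
               others _ (i≤a , j≤b , k≤d) (i≢i₀ ∘ cong (coord x)))
    (≈-trans (sumTo-single b _ j₀ j₀≤b λ j j≤b j≢j₀ →
               sumTo-zero d _ λ k k≤d → others _ (i₀≤a , j≤b , k≤d) (j≢j₀ ∘ cong (coord y)))
             (sumTo-single d _ k₀ k₀≤d λ k k≤d k≢k₀ →
               others _ (i₀≤a , j₀≤b , k≤d) (k≢k₀ ∘ cong (coord z))))

  mul-zero : ∀ (h g : Coeffs) → (∀ m → h m ≈ 0#) → ∀ m → mul h g m ≈ 0#
  mul-zero h g vanish (a , b , d) =
    sumTo-zero a _ λ i _ → sumTo-zero b _ λ j _ → sumTo-zero d _ λ k _ →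
    ≈-trans (*-cong (vanish _) ≈-refl) (zeroˡ _)

  gen-cases : ∀ n → gen n ≈ 0# ⊎ ∃ λ e → n ≡ sq e
  gen-cases (2 , 0 , 0) = inj₂ (x , refl)
  gen-cases (0 , 2 , 0) = inj₂ (y , refl)
  gen-cases (0 , 0 , 2) = inj₂ (z , refl)
  gen-cases (0 , 0 , 0) = inj₁ ≈-refl
  gen-cases (0 , 0 , 1) = inj₁ ≈-refl
  gen-cases (0 , 0 , suc (suc (suc d))) = inj₁ ≈-refl
  gen-cases (0 , 1 , d) = inj₁ ≈-refl
  gen-cases (0 , 2 , suc d) = inj₁ ≈-refl
  gen-cases (0 , suc (suc (suc b)) , d) = inj₁ ≈-refl
  gen-cases (1 , b , d) = inj₁ ≈-refl
  gen-cases (2 , 0 , suc d) = inj₁ ≈-refl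
  gen-cases (2 , suc b , d) = inj₁ ≈-refl
  gen-cases (suc (suc (suc a)) , b , d) = inj₁ ≈-refl

  gen-sq : ∀ e → gen (sq e) ≈ 1#
  gen-sq x = ≈-refl
  gen-sq y = ≈-refl
  gen-sq z = ≈-refl

  TopAlong : Axis → Coeffs → Monomial → Set ℓ
  TopAlong e h p = ∀ m → coord e p < coord e m → h m ≈ 0#

  -- If h vanishes above p along e, then h·(x²+y²+z²) has coefficient h(p) at e²·p:
  -- any other contribution h(i)·gen(e²p − i) has coord e i ≤ coord e p, so the
  -- square e²p − i has a positive e-exponent and must be e², forcing i = p.
  leading-coefficient : ∀ e h p → TopAlong e h p → mul h gen (bump e p) ≈ h p
  leading-coefficient e h p top =
    ≈-trans (mul-single-term h gen (bump e p) p (≤ₘ-bump e p) others)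
            (≈-trans (*-cong ≈-refl (≈-trans (≈-reflexive (cong gen (bump-∸ₘ e p))) (gen-sq e)))
                     (*-identityʳ (h p)))
    where
    e-exponent-positive : ∀ i → coord e i ≤ coord e p → coord e (bump e p ∸ₘ i) ≢ 0
    e-exponent-positive i i≤p rewrite coord-∸ₘ e (bump e p) i | coord-bump e p =
      m>n⇒m∸n≢0 (s≤s (m≤n⇒m≤1+n i≤p))

    others : ∀ i → i ≤ₘ bump e p → i ≢ p → h i * gen (bump e p ∸ₘ i) ≈ 0#
    others i i≤ i≢p with coord e p <? coord e i
    ... | yes above = ≈-trans (*-cong (top i above) ≈-refl) (zeroˡ _)
    ... | no notAbove with gen-cases (bump e p ∸ₘ i)
    ...   | inj₁ vanishes      = ≈-trans (*-cong ≈-refl vanishes) (zeroʳ _)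
    ...   | inj₂ (e' , is-sq) with sq-axis e e' (subst (λ n → coord e n ≢ 0) is-sq
                                                   (e-exponent-positive i (≮⇒≥ notAbove)))
    ...     | refl = ⊥-elim (i≢p (∸ₘ-cancelˡ i≤ (≤ₘ-bump e p) (trans is-sq (sym (bump-∸ₘ e p)))))

  -- Leading monomials along different axes differ: e²p has e-exponent larger
  -- than that of any term of h, in particular than that of e'²q.
  leading-monomials-distinct : ∀ e e' h p q → e ≢ e' → TopAlong e h p → ¬ (h q ≈ 0#) →
    bump e p ≢ bump e' q
  leading-monomials-distinct e e' h p q e≢e' top q≉0 eq with coord-bump-other e e' q
  ... | inj₁ e≡e'  = e≢e' e≡e'
  ... | inj₂ same = 1+n≰n (≤-trans (n≤1+n _) (subst (_≤ coord e p) e-exponents q≤p))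
    where
    q≤p : coord e q ≤ coord e p
    q≤p = ≮⇒≥ λ p<q → q≉0 (top q p<q)
    e-exponents : coord e q ≡ 2 +ℕ coord e p
    e-exponents = trans (sym same) (trans (cong (coord e) (sym eq)) (coord-bump e p))

  no-three-terms : ∀ (f : Coeffs) m₁ m₂ → (∀ m → m ≢ m₁ → m ≢ m₂ → f m ≈ 0#) →
    ∀ t₁ t₂ t₃ → ¬ (f t₁ ≈ 0#) → ¬ (f t₂ ≈ 0#) → ¬ (f t₃ ≈ 0#) →
    t₁ ≢ t₂ → t₁ ≢ t₃ → t₂ ≢ t₃ → ⊥
  no-three-terms f m₁ m₂ two-terms t₁ t₂ t₃ f₁ f₂ f₃ d₁₂ d₁₃ d₂₃ =
    in-support t₁ f₁ λ s₁ → in-support t₂ f₂ λ s₂ → in-support t₃ f₃ λ s₃ →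
    [ d₁₂ , [ d₁₃ , d₂₃ ]′ ]′ (pigeonhole s₁ s₂ s₃)
    where
    in-support : ∀ t → ¬ (f t ≈ 0#) → ¬ ¬ (t ≡ m₁ ⊎ t ≡ m₂)
    in-support t ft≉0 k = ft≉0 (two-terms t (k ∘ inj₁) (k ∘ inj₂))

  ¬¬-coefficients-decidable : ∀ h → FinSupp h → ¬ ¬ Decidable (λ m → h m ≈ 0#)
  ¬¬-coefficients-decidable h (N , vanish) =
    ¬¬-∀-cofinite N (λ a b d above → yes (vanish a b d above)) (λ _ → ¬¬-excluded-middle)

  vanishes-along : ∀ e h → FinSupp h → ∃ λ n → ∀ m → n ≤ coord e m → h m ≈ 0#
  vanishes-along e h (N , vanish) =
    suc N , λ { (a , b , d) above → vanish a b d (≤-trans above (coord-≤-degree e a b d)) }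

  top-along : ∀ h → FinSupp h → ¬ (∀ m → h m ≈ 0#) → Decidable (λ m → h m ≈ 0#) →
    ∀ e → ¬ ¬ ∃ λ p → ¬ (h p ≈ 0#) × TopAlong e h p
  top-along h h-finite h≢0 h? e =
    TopDegree.top-exists (λ m → h m ≈ 0#) h? (coord e) (vanishes-along e h h-finite) h≢0

lemma2p9 : ∀ {c ℓ : Level} (K : Field c ℓ) (f : Poly3.Coeffs K) →
    Poly3.IsBinomial K f → Poly3.NonZeroPoly K f →
    ¬ Poly3.InPrincipalIdeal K (Poly3.gen K) f
lemma2p9 K f (_ , m₁ , m₂ , two-terms) (m₀ , f≉0) (h , h-finite , f≈hg) =
  ¬¬-coefficients-decidable h h-finite λ h? →
  top-along h h-finite h≢0 h? x λ (p , hp≉0 , p-top) →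
  top-along h h-finite h≢0 h? y λ (q , hq≉0 , q-top) →
  top-along h h-finite h≢0 h? z λ (r , hr≉0 , r-top) →
  no-three-terms f m₁ m₂ two-terms (bump x p) (bump y q) (bump z r)
    (leading-term x p p-top hp≉0) (leading-term y q q-top hq≉0) (leading-term z r r-top hr≉0)
    (leading-monomials-distinct x y h p q (λ ()) p-top hq≉0)
    (leading-monomials-distinct x z h p r (λ ()) p-top hr≉0)
    (leading-monomials-distinct y z h q r (λ ()) q-top hr≉0)
  where
  open Field K using (_≈_; 0#) renaming (sym to ≈-sym; trans to ≈-trans)
  open Poly3 K using (gen)
  open Polynomials K

  h≢0 : ¬ (∀ m → h m ≈ 0#)
  h≢0 h≈0 = f≉0 (≈-trans (f≈hg m₀) (mul-zero h gen h≈0 m₀))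

  leading-term : ∀ e p → TopAlong e h p → ¬ (h p ≈ 0#) → ¬ (f (bump e p) ≈ 0#)
  leading-term e p top hp≉0 fe²p≈0 =
    hp≉0 (≈-trans (≈-sym (leading-coefficient e h p top)) (≈-trans (≈-sym (f≈hg (bump e p))) fe²p≈0))
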